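{- Let $k\ge 1$ and $p_1,p_2\geq k$ be integers, and let $K_{p_1}\circ_{k}K_{p_2}$ be the $k$-coalescence of the complete graphs $K_{p_1}$ and $K_{p_2}$, which has $t=p_1+p_2-k$ vertices. Let $T$ be the set of $k$ vertices of $K_{p_1}\circ_{k}K_{p_2}$ obtained by identifying vertices of $K_{p_1}$ with vertices of $K_{p_2}$. Write $r_{ij}$ for the resistance distance between vertices $v_i$ and $v_j$ of $K_{p_1}\circ_{k}K_{p_2}$. Then: (i) for any distinct $v_i, v_j\in T$, $r_{ij}= \frac{2}{t}$; (ii) for $v_i\in T$, $v_j\in V(K_{p_1})\setminus T$, $r_{ij}= \frac{(k+1)(p_2-k)+2p_1k}{kp_1t}$; (iii) for $v_i\in T$, $v_j\in V(K_{p_2})\setminus T$, $r_{ij}= \frac{(k+1)(p_1-k)+2p_2k}{kp_2t}$; (iv) for any distinct $v_i, v_j\in V(K_{p_1})\setminus T$, $r_{ij}= \frac{2}{p_1}$; (v) for $v_i\in V(K_{p_1})\setminus T$, $v_j\in V(K_{p_2})\setminus T$, $r_{ij}= \frac{(p_1+p_2)(k+1)}{kp_1p_2}$; (vi) for any distinct $v_i, v_j\in V(K_{p_2})\setminus T$, $r_{ij}= \frac{2}{p_2}$.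
   Context: All graphs are simple, connected and undirected. The resistance distance $r_{ij}$ between vertices $v_i,v_j$ of a graph is the effective resistance between them when every edge is a resistor of $1\Omega$; equivalently $r_{ij}=l^{\#}_{ii}+l^{\#}_{jj}-2l^{\#}_{ij}$, where $(l^{\#}_{ij})$ is the group inverse of the Laplacian matrix $L=D-A$. For two graphs $G$, $G'$ each containing an induced complete subgraph $K_k$, the $k$-coalescence $G\circ_k G'$ is the graph obtained by identifying the $k$ vertices of an induced $K_k$ in $G$ with the $k$ vertices of an induced $K_k$ in $G'$ (the $\binom{k}{2}$ edges among them being identified as well); it has $|V(G)|+|V(G')|-k$ vertices and $|E(G)|+|E(G')|-\binom{k}{2}$ edges. Here $K_{p_1}\circ_k K_{p_2}$ is obtained by identifying $k$ vertices of $K_{p_1}$ with $k$ vertices of $K_{p_2}$. -}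

module Defs where

open import Data.Nat as ℕ using (ℕ; zero; suc; _<_; _≤_; _∸_)
open import Data.Integer using (+_)
open import Data.Fin as Fin using (Fin; toℕ; _≟_)
open import Data.Bool using (Bool; true; false; if_then_else_)
import Data.Bool
open import Data.Product using (_×_)
open import Relation.Nullary using (does; ¬_)
open import Relation.Binary.PropositionalEquality using (_≡_)
open import Data.Rational using (ℚ; 0ℚ; 1ℚ; _+_; _*_; _-_; _/_)

Matrix : ℕ → Set
Matrix n = Fin n → Fin n → ℚ

sumFin : (n : ℕ) → (Fin n → ℚ) → ℚ
sumFin zero    f = 0ℚ
sumFin (suc n) f = f Fin.zero + sumFin n (λ i → f (Fin.suc i))

_⊗_ : {n : ℕ} → Matrix n → Matrix n → Matrix n
_⊗_ {n} M N i j = sumFin n (λ l → M i l * N l j)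

AdjRel : ℕ → Set
AdjRel n = Fin n → Fin n → Bool

adjacencyMatrix : {n : ℕ} → AdjRel n → Matrix n
adjacencyMatrix adj i j = if adj i j then 1ℚ else 0ℚ

degree : {n : ℕ} → AdjRel n → Fin n → ℚ
degree {n} adj i = sumFin n (adjacencyMatrix adj i)

laplacian : {n : ℕ} → AdjRel n → Matrix n
laplacian adj i j =
  (if does (i ≟ j) then degree adj i else 0ℚ) - adjacencyMatrix adj i j

IsGroupInverse : {n : ℕ} → Matrix n → Matrix n → Set
IsGroupInverse M X =
  (∀ i j → ((M ⊗ X) ⊗ M) i j ≡ M i j) ×
  (∀ i j → ((X ⊗ M) ⊗ X) i j ≡ X i j) ×
  (∀ i j → (M ⊗ X) i j ≡ (X ⊗ M) i j)

-- resistance distance computed from the group inverse X of the Laplacian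
resistance : {n : ℕ} → Matrix n → Fin n → Fin n → ℚ
resistance X i j = (X i i + X j j) - ((+ 2 / 1) * X i j)

-- the fraction a/d in ℚ (only used with d ≠ 0; the value for d = 0 is irrelevant)
frac : ℕ → ℕ → ℚ
frac a zero    = 0ℚ
frac a (suc d) = (+ a) / suc d

-- Concrete labelling of K_{p1} ∘_k K_{p2} on vertices Fin (p1 + p2 ∸ k):
--   vertices 0..k-1          : T (the identified vertices)
--   vertices k..p1-1         : V(K_{p1}) \ T
--   vertices p1..p1+p2-k-1   : V(K_{p2}) \ T
-- V(K_{p1}) = {v | v < p1},  V(K_{p2}) = {v | v < k or v ≥ p1}.
inK1 : (k p1 : ℕ) → ℕ → Bool
inK1 k p1 v = does (v ℕ.<? p1)

inK2 : (k p1 : ℕ) → ℕ → Bool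
inK2 k p1 v = does (v ℕ.<? k) Data.Bool.∨ does (p1 ℕ.≤? v)

coalAdj : (k p1 p2 : ℕ) → AdjRel (p1 ℕ.+ p2 ∸ k)
coalAdj k p1 p2 i j =
  Data.Bool.not (does (i ≟ j)) Data.Bool.∧
  ((inK1 k p1 (toℕ i) Data.Bool.∧ inK1 k p1 (toℕ j)) Data.Bool.∨
   (inK2 k p1 (toℕ i) Data.Bool.∧ inK2 k p1 (toℕ j)))

InT : (k p1 : ℕ) {t : ℕ} → Fin t → Set
InT k p1 v = toℕ v < k

InK1∖T : (k p1 : ℕ) {t : ℕ} → Fin t → Set
InK1∖T k p1 v = (k ≤ toℕ v) × (toℕ v < p1)

InK2∖T : (k p1 : ℕ) {t : ℕ} → Fin t → Set
InK2∖T k p1 v = p1 ≤ toℕ v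

module Submission where

-- The vertices of K_{p₁} ∘_k K_{p₂} fall into three classes: the k shared vertices T and the
-- private parts K_{p₁} ∖ T, K_{p₂} ∖ T. The Laplacian L, and the candidate X for its group
-- inverse, are "block matrices": an entry depends only on the classes of its row and column,
-- plus a class-dependent term on the diagonal. Such matrices are closed under products, which
-- are computed class by class, so L X = X L = I − J/t, (I − J/t) L = L and (I − J/t) X = X
-- become finitely many polynomial identities in k, p₁, p₂ and d = 1/(k p₁ p₂ t²). Hence X is a
-- group inverse, it is the only one, and r_ij = X_ii + X_jj − 2 X_ij is read off the blocks.

open import Defs
open import Algebra.Bundles using (CommutativeRing)
open import Algebra.Bundles.Raw using (RawRing)
open import Data.Bool using (Bool; true; false; if_then_else_; not; _∧_; _∨_)
open import Data.Fin using (Fin; zero; suc; toℕ; _≟_)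
open import Data.Fin.Patterns using (0F; 1F; 2F; 3F)
import Data.Integer as ℤ
import Data.Integer.Properties as ℤ
import Data.Integer.Tactic.RingSolver as ℤ-Solver
open import Data.Nat using (ℕ; zero; suc; z≤n; s≤s; _≤_; _<_; _<?_; _≤?_)
import Data.Nat.Properties as ℕ
open import Data.Product using (Σ; _×_; _,_)
open import Data.Rational using (ℚ; 0ℚ; 1ℚ)
import Data.Rational as ℚ
import Data.Rational.Properties as ℚ
open import Data.Rational.Unnormalised using (mkℚᵘ; *≡*)
import Data.Rational.Unnormalised as ℚᵘ
import Data.Rational.Unnormalised.Properties as ℚᵘ
open import Data.Vec using (Vec; []; _∷_)
open import Function using (_∘_)
open import Level using (0ℓ)
open import Relation.Binary.Bundles using (Setoid)
open import Relation.Binary.PropositionalEquality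
  using (_≡_; refl; sym; trans; cong; cong₂; subst; module ≡-Reasoning)
open import Relation.Nullary using (¬_; Dec; yes; no; does)
open import Relation.Nullary.Decidable using (dec⇒maybe; dec-true; dec-false)
open import Tactic.RingSolver.Core.AlmostCommutativeRing
  using (AlmostCommutativeRing; fromCommutativeRing)
open import Algebra.Properties.Semiring.Sum (CommutativeRing.semiring ℚ.+-*-commutativeRing)
  using (sum; sum-cong-≗; ∑-distrib-+; ∑-comm; *-distribˡ-sum; *-distribʳ-sum)

ℚ-ring : AlmostCommutativeRing 0ℓ 0ℓ
ℚ-ring = fromCommutativeRing ℚ.+-*-commutativeRing (λ x → dec⇒maybe (0ℚ ℚ.≟ x))

import Tactic.RingSolver.NonReflective ℚ-ring as Poly
open Poly using (Expr; Κ; Ι; _⊕_; _⊜_) renaming (_⊗_ to _⊠_)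

symbolicRing : ℕ → RawRing 0ℓ 0ℓ
symbolicRing n = record
  { Carrier = Expr ℚ n
  ; _≈_     = _≡_
  ; _+_     = _⊕_
  ; _*_     = _⊠_
  ; -_      = Poly.⊝_
  ; 0#      = Κ 0ℚ
  ; 1#      = Κ 1ℚ
  }

data Part : Set where
  common only₁ only₂ : Part

member₁ member₂ : Part → Bool
member₁ only₂ = false
member₁ _     = true
member₂ only₁ = false
member₂ _     = true

adjacent : Part → Part → Bool
adjacent x y = (member₁ x ∧ member₁ y) ∨ (member₂ x ∧ member₂ y)

adjacent-refl : ∀ x → adjacent x x ≡ true
adjacent-refl common = refl
adjacent-refl only₁  = refl
adjacent-refl only₂  = refl

-- A value of Blocks stands for the matrix with entries [i = j] · diag (part i) + off (part i) (part j),
-- where the class x has size x elements; _·_ is the product of such matrices, Σᵖ summing over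
-- the vertices class by class.
module BlockAlgebra {c ℓ} (R : RawRing c ℓ) (size : Part → RawRing.Carrier R) where
  open RawRing R

  Σᵖ : (Part → Carrier) → Carrier
  Σᵖ g = size common * g common + (size only₁ * g only₁ + size only₂ * g only₂)

  record Blocks : Set c where
    constructor blocks
    field
      diag : Part → Carrier
      off  : Part → Part → Carrier
  open Blocks public

  infixl 7 _·_
  _·_ : Blocks → Blocks → Blocks
  M · N = blocks (λ x → diag M x * diag N x)
    (λ x y → diag M x * off N x y + off M x y * diag N y + Σᵖ (λ e → off M x e * off N e y))

  columnSum : Blocks → Part → Carrier
  columnSum M y = diag M y + Σᵖ (λ e → off M e y)

  2# : Carrier
  2# = 1# + 1#

  blockResistance : Blocks → Part → Part → Carrier
  blockResistance M x y = (diag M x + off M x x) + (diag M y + off M y y) + - (2# * off M x y)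

module CoalescenceBlocks {c ℓ} (R : RawRing c ℓ) (k p₁ p₂ d : RawRing.Carrier R) where
  open RawRing R

  infixl 6 _-_
  _-_ : Carrier → Carrier → Carrier
  x - y = x + - y

  t : Carrier
  t = p₁ + p₂ - k

  size : Part → Carrier
  size common = k
  size only₁  = p₁ - k
  size only₂  = p₂ - k

  open BlockAlgebra R size public

  𝟙 : Bool → Carrier
  𝟙 b = if b then 1# else 0#

  -- Distinct vertices in classes x and y are adjacent iff adjacent x y; as the block term
  -- − 𝟙 (adjacent x x) = −1 also sits on the diagonal, the diagonal term is the degree plus one.
  L : Blocks
  L = blocks (λ x → Σᵖ (𝟙 ∘ adjacent x)) (λ x y → - 𝟙 (adjacent x y))

  -- The paper's L^#, each entry written over the common denominator k p₁ p₂ t² = 1/d.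
  X : Blocks
  X = blocks diagonal offDiagonal
    where
    diagonal : Part → Carrier
    diagonal common = k * p₁ * p₂ * t * d
    diagonal only₁  = k * p₂ * t * t * d
    diagonal only₂  = k * p₁ * t * t * d
    offDiagonal : Part → Part → Carrier
    offDiagonal only₁ only₁ = p₂ * (t * t - p₁ * (p₁ + p₂)) * d
    offDiagonal only₂ only₂ = p₁ * (t * t - p₂ * (p₁ + p₂)) * d
    offDiagonal only₁ only₂ = - (p₁ * p₂ * (p₁ + p₂) * d)
    offDiagonal only₂ only₁ = - (p₁ * p₂ * (p₁ + p₂) * d)
    offDiagonal _     _     = - (k * p₁ * p₂ * d)

  Δ : Carrier
  Δ = k * p₁ * p₂ * t * t

  -- I − J/t, once Δ d = 1.
  P : Blocks
  P = blocks (λ _ → Δ * d) (λ _ _ → - (k * p₁ * p₂ * t * d))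

module BlockIdentities (k p₁ p₂ d : ℚ) where
  open CoalescenceBlocks ℚ.+-*-rawRing k p₁ p₂ d
  open import Data.Rational using (_+_; _*_)

  private
    k̂ p̂₁ p̂₂ d̂ : Expr ℚ 4
    k̂  = Ι 0F
    p̂₁ = Ι 1F
    p̂₂ = Ι 2F
    d̂  = Ι 3F

    module S = CoalescenceBlocks (symbolicRing 4) k̂ p̂₁ p̂₂ d̂
    open Poly.Ops using (⟦_⟧; ⟦_⇓⟧; prove)

    ρ : Vec ℚ 4
    ρ = k ∷ p₁ ∷ p₂ ∷ d ∷ []

    byNormalForm : (e₁ e₂ : Expr ℚ 4) → ⟦ e₁ ⇓⟧ ρ ≡ ⟦ e₂ ⇓⟧ ρ → ⟦ e₁ ⟧ ρ ≡ ⟦ e₂ ⟧ ρ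
    byNormalForm = prove ρ

    offDiagonals : (M N : S.Blocks) (x y : Part) →
      ⟦ S.off M x y ⇓⟧ ρ ≡ ⟦ S.off N x y ⇓⟧ ρ → ⟦ S.off M x y ⟧ ρ ≡ ⟦ S.off N x y ⟧ ρ
    offDiagonals M N x y = byNormalForm (S.off M x y) (S.off N x y)

    diagonals : (M N : S.Blocks) (x : Part) →
      ⟦ S.diag M x ⇓⟧ ρ ≡ ⟦ S.diag N x ⇓⟧ ρ → ⟦ S.diag M x ⟧ ρ ≡ ⟦ S.diag N x ⟧ ρ
    diagonals M N x = byNormalForm (S.diag M x) (S.diag N x)

    vanishes : (e : Expr ℚ 4) → ⟦ e ⇓⟧ ρ ≡ ⟦ Κ 0ℚ ⇓⟧ ρ → ⟦ e ⟧ ρ ≡ 0ℚ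
    vanishes e = byNormalForm e (Κ 0ℚ)

  L·X-diag : ∀ x → diag (L · X) x ≡ diag P x
  L·X-diag common = diagonals (S.L S.· S.X) S.P common refl
  L·X-diag only₁  = diagonals (S.L S.· S.X) S.P only₁ refl
  L·X-diag only₂  = diagonals (S.L S.· S.X) S.P only₂ refl

  L·X-off : ∀ x y → off (L · X) x y ≡ off P x y
  L·X-off common common = offDiagonals (S.L S.· S.X) S.P common common refl
  L·X-off common only₁  = offDiagonals (S.L S.· S.X) S.P common only₁ refl
  L·X-off common only₂  = offDiagonals (S.L S.· S.X) S.P common only₂ refl
  L·X-off only₁  common = offDiagonals (S.L S.· S.X) S.P only₁ common refl
  L·X-off only₁  only₁  = offDiagonals (S.L S.· S.X) S.P only₁ only₁ refl
  L·X-off only₁  only₂  = offDiagonals (S.L S.· S.X) S.P only₁ only₂ refl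
  L·X-off only₂  common = offDiagonals (S.L S.· S.X) S.P only₂ common refl
  L·X-off only₂  only₁  = offDiagonals (S.L S.· S.X) S.P only₂ only₁ refl
  L·X-off only₂  only₂  = offDiagonals (S.L S.· S.X) S.P only₂ only₂ refl

  X·L-diag : ∀ x → diag (X · L) x ≡ diag P x
  X·L-diag x = trans (ℚ.*-comm (diag X x) (diag L x)) (L·X-diag x)

  X·L-off : ∀ x y → off (X · L) x y ≡ off P x y
  X·L-off common common = offDiagonals (S.X S.· S.L) S.P common common refl
  X·L-off common only₁  = offDiagonals (S.X S.· S.L) S.P common only₁ refl
  X·L-off common only₂  = offDiagonals (S.X S.· S.L) S.P common only₂ refl
  X·L-off only₁  common = offDiagonals (S.X S.· S.L) S.P only₁ common refl
  X·L-off only₁  only₁  = offDiagonals (S.X S.· S.L) S.P only₁ only₁ refl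
  X·L-off only₁  only₂  = offDiagonals (S.X S.· S.L) S.P only₁ only₂ refl
  X·L-off only₂  common = offDiagonals (S.X S.· S.L) S.P only₂ common refl
  X·L-off only₂  only₁  = offDiagonals (S.X S.· S.L) S.P only₂ only₁ refl
  X·L-off only₂  only₂  = offDiagonals (S.X S.· S.L) S.P only₂ only₂ refl

  L-columnSum : ∀ y → columnSum L y ≡ 0ℚ
  L-columnSum common = vanishes (S.columnSum S.L common) refl
  L-columnSum only₁  = vanishes (S.columnSum S.L only₁) refl
  L-columnSum only₂  = vanishes (S.columnSum S.L only₂) refl

  X-columnSum : ∀ y → columnSum X y ≡ 0ℚ
  X-columnSum common = vanishes (S.columnSum S.X common) refl
  X-columnSum only₁  = vanishes (S.columnSum S.X only₁) refl
  X-columnSum only₂  = vanishes (S.columnSum S.X only₂) refl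

  blockResistance-T-T : t * blockResistance X common common ≡ 2# * (Δ * d)
  blockResistance-T-T = byNormalForm
    (S.t ⊠ S.blockResistance S.X common common)
    (S.2# ⊠ (S.Δ ⊠ d̂)) refl

  blockResistance-T-K₁ : k * p₁ * t * blockResistance X common only₁
                       ≡ ((k + 1ℚ) * (p₂ - k) + 2# * p₁ * k) * (Δ * d)
  blockResistance-T-K₁ = byNormalForm
    (k̂ ⊠ p̂₁ ⊠ S.t ⊠ S.blockResistance S.X common only₁)
    (((k̂ ⊕ Κ 1ℚ) ⊠ (p̂₂ S.- k̂) ⊕ S.2# ⊠ p̂₁ ⊠ k̂) ⊠ (S.Δ ⊠ d̂)) refl

  blockResistance-T-K₂ : k * p₂ * t * blockResistance X common only₂
                       ≡ ((k + 1ℚ) * (p₁ - k) + 2# * p₂ * k) * (Δ * d)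
  blockResistance-T-K₂ = byNormalForm
    (k̂ ⊠ p̂₂ ⊠ S.t ⊠ S.blockResistance S.X common only₂)
    (((k̂ ⊕ Κ 1ℚ) ⊠ (p̂₁ S.- k̂) ⊕ S.2# ⊠ p̂₂ ⊠ k̂) ⊠ (S.Δ ⊠ d̂)) refl

  blockResistance-K₁-K₁ : p₁ * blockResistance X only₁ only₁ ≡ 2# * (Δ * d)
  blockResistance-K₁-K₁ = byNormalForm
    (p̂₁ ⊠ S.blockResistance S.X only₁ only₁)
    (S.2# ⊠ (S.Δ ⊠ d̂)) refl

  blockResistance-K₁-K₂ : k * p₁ * p₂ * blockResistance X only₁ only₂
                        ≡ (p₁ + p₂) * (k + 1ℚ) * (Δ * d)
  blockResistance-K₁-K₂ = byNormalForm
    (k̂ ⊠ p̂₁ ⊠ p̂₂ ⊠ S.blockResistance S.X only₁ only₂)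
    ((p̂₁ ⊕ p̂₂) ⊠ (k̂ ⊕ Κ 1ℚ) ⊠ (S.Δ ⊠ d̂)) refl

  blockResistance-K₂-K₂ : p₂ * blockResistance X only₂ only₂ ≡ 2# * (Δ * d)
  blockResistance-K₂-K₂ = byNormalForm
    (p̂₂ ⊠ S.blockResistance S.X only₂ only₂)
    (S.2# ⊠ (S.Δ ⊠ d̂)) refl

module MatrixAlgebra where
  open import Data.Rational using (_+_; _*_; _-_)
  open ≡-Reasoning

  sumFin≡sum : ∀ n (f : Fin n → ℚ) → sumFin n f ≡ sum f
  sumFin≡sum zero    f = refl
  sumFin≡sum (suc n) f = cong (f zero +_) (sumFin≡sum n (f ∘ suc))

  δ : ∀ {n} → Fin n → Fin n → ℚ
  δ i j = if does (i ≟ j) then 1ℚ else 0ℚ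

  δ-refl : ∀ {n} (i : Fin n) → δ i i ≡ 1ℚ
  δ-refl i = cong (if_then 1ℚ else 0ℚ) (dec-true (i ≟ i) refl)

  δ-≢ : ∀ {n} {i j : Fin n} → ¬ i ≡ j → δ i j ≡ 0ℚ
  δ-≢ {i = i} {j} i≢j = cong (if_then 1ℚ else 0ℚ) (dec-false (i ≟ j) i≢j)

  if≡δ* : ∀ {n} (i j : Fin n) x → (if does (i ≟ j) then x else 0ℚ) ≡ δ i j * x
  if≡δ* i j x with does (i ≟ j)
  ... | true  = sym (ℚ.*-identityˡ x)
  ... | false = sym (ℚ.*-zeroˡ x)

  sum-0* : ∀ {n} (f : Fin n → ℚ) → sum (λ l → 0ℚ * f l) ≡ 0ℚ
  sum-0* f = trans (sym (*-distribˡ-sum 0ℚ f)) (ℚ.*-zeroˡ (sum f))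

  sum-δˡ : ∀ {n} (i : Fin n) (f : Fin n → ℚ) → sum (λ l → δ i l * f l) ≡ f i
  sum-δˡ zero    f = begin
    1ℚ * f zero + sum (λ l → 0ℚ * f (suc l)) ≡⟨ cong₂ _+_ (ℚ.*-identityˡ (f zero)) (sum-0* (f ∘ suc)) ⟩
    f zero + 0ℚ                             ≡⟨ ℚ.+-identityʳ (f zero) ⟩
    f zero                                  ∎
  sum-δˡ (suc i) f = begin
    0ℚ * f zero + sum (λ l → δ i l * f (suc l)) ≡⟨ cong (_+ sum (λ l → δ i l * f (suc l))) (ℚ.*-zeroˡ (f zero)) ⟩
    0ℚ + sum (λ l → δ i l * f (suc l))         ≡⟨ ℚ.+-identityˡ _ ⟩
    sum (λ l → δ i l * f (suc l))              ≡⟨ sum-δˡ i (f ∘ suc) ⟩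
    f (suc i)                                   ∎

  sum-δʳ : ∀ {n} (j : Fin n) (f : Fin n → ℚ) → sum (λ l → δ l j * f l) ≡ f j
  sum-δʳ zero    f = begin
    1ℚ * f zero + sum (λ l → 0ℚ * f (suc l)) ≡⟨ cong₂ _+_ (ℚ.*-identityˡ (f zero)) (sum-0* (f ∘ suc)) ⟩
    f zero + 0ℚ                             ≡⟨ ℚ.+-identityʳ (f zero) ⟩
    f zero                                  ∎
  sum-δʳ (suc j) f = begin
    0ℚ * f zero + sum (λ l → δ l j * f (suc l)) ≡⟨ cong (_+ sum (λ l → δ l j * f (suc l))) (ℚ.*-zeroˡ (f zero)) ⟩
    0ℚ + sum (λ l → δ l j * f (suc l))         ≡⟨ ℚ.+-identityˡ _ ⟩
    sum (λ l → δ l j * f (suc l))              ≡⟨ sum-δʳ j (f ∘ suc) ⟩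
    f (suc j)                                   ∎

  infix 4 _≐_
  _≐_ : ∀ {n} → Matrix n → Matrix n → Set
  M ≐ N = ∀ i j → M i j ≡ N i j

  ≐-setoid : ℕ → Setoid 0ℓ 0ℓ
  ≐-setoid n = record
    { Carrier       = Matrix n
    ; _≈_           = _≐_
    ; isEquivalence = record
      { refl  = λ i j → refl
      ; sym   = λ p i j → sym (p i j)
      ; trans = λ p q i j → trans (p i j) (q i j)
      }
    }

  module _ {n : ℕ} where
    open Setoid (≐-setoid n) public using () renaming (refl to ≐-refl; sym to ≐-sym; trans to ≐-trans)

  ⊗≡sum : ∀ {n} (M N : Matrix n) i j → (M ⊗ N) i j ≡ sum (λ l → M i l * N l j)
  ⊗≡sum {n} M N i j = sumFin≡sum n (λ l → M i l * N l j)

  ⊗-cong : ∀ {n} {M M′ N N′ : Matrix n} → M ≐ M′ → N ≐ N′ → M ⊗ N ≐ M′ ⊗ N′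
  ⊗-cong {M = M} {M′} {N} {N′} M≐M′ N≐N′ i j = begin
    (M ⊗ N) i j                   ≡⟨ ⊗≡sum M N i j ⟩
    sum (λ l → M i l * N l j)     ≡⟨ sum-cong-≗ (λ l → cong₂ _*_ (M≐M′ i l) (N≐N′ l j)) ⟩
    sum (λ l → M′ i l * N′ l j)   ≡⟨ ⊗≡sum M′ N′ i j ⟨
    (M′ ⊗ N′) i j                 ∎

  ⊗-assoc : ∀ {n} (M N P : Matrix n) → (M ⊗ N) ⊗ P ≐ M ⊗ (N ⊗ P)
  ⊗-assoc M N P i j = begin
    ((M ⊗ N) ⊗ P) i j
      ≡⟨ ⊗≡sum (M ⊗ N) P i j ⟩
    sum (λ l → (M ⊗ N) i l * P l j)
      ≡⟨ sum-cong-≗ (λ l → cong (_* P l j) (⊗≡sum M N i l)) ⟩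
    sum (λ l → sum (λ m → M i m * N m l) * P l j)
      ≡⟨ sum-cong-≗ (λ l → *-distribʳ-sum (P l j) (λ m → M i m * N m l)) ⟩
    sum (λ l → sum (λ m → M i m * N m l * P l j))
      ≡⟨ ∑-comm (λ l m → M i m * N m l * P l j) ⟩
    sum (λ m → sum (λ l → M i m * N m l * P l j))
      ≡⟨ sum-cong-≗ (λ m → sum-cong-≗ (λ l → ℚ.*-assoc (M i m) (N m l) (P l j))) ⟩
    sum (λ m → sum (λ l → M i m * (N m l * P l j)))
      ≡⟨ sum-cong-≗ (λ m → *-distribˡ-sum (M i m) (λ l → N m l * P l j)) ⟨
    sum (λ m → M i m * sum (λ l → N m l * P l j))
      ≡⟨ sum-cong-≗ (λ m → cong (M i m *_) (⊗≡sum N P m j)) ⟨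
    sum (λ m → M i m * (N ⊗ P) m j)
      ≡⟨ ⊗≡sum M (N ⊗ P) i j ⟨
    (M ⊗ (N ⊗ P)) i j
      ∎

  resistance-cong : ∀ {n} {X Y : Matrix n} → X ≐ Y → ∀ i j → resistance X i j ≡ resistance Y i j
  resistance-cong X≐Y i j = cong₂ _-_ (cong₂ _+_ (X≐Y i i) (X≐Y j j)) (cong ((1ℚ + 1ℚ) *_) (X≐Y i j))

open MatrixAlgebra

module GroupInverses {n : ℕ} where
  open import Relation.Binary.Reasoning.Setoid (≐-setoid n)

  isGroupInverse-unique : ∀ {M X Y : Matrix n} →
    IsGroupInverse M X → IsGroupInverse M Y → X ≐ Y
  isGroupInverse-unique {M} {X} {Y} (MXM≐M , XMX≐X , MX≐XM) (MYM≐M , YMY≐Y , MY≐YM) = begin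
    X               ≈⟨ XMX≐X ⟨
    (X ⊗ M) ⊗ X     ≈⟨ ⊗-assoc X M X ⟩
    X ⊗ (M ⊗ X)     ≈⟨ ⊗-cong (≐-refl {x = X}) MX≐MY ⟩
    X ⊗ (M ⊗ Y)     ≈⟨ ⊗-assoc X M Y ⟨
    (X ⊗ M) ⊗ Y     ≈⟨ ⊗-cong (≐-trans (≐-sym MX≐XM) MX≐MY) (≐-refl {x = Y}) ⟩
    (M ⊗ Y) ⊗ Y     ≈⟨ ⊗-cong MY≐YM (≐-refl {x = Y}) ⟩
    (Y ⊗ M) ⊗ Y     ≈⟨ YMY≐Y ⟩
    Y               ∎
    where
    -- M X and M Y are both equal to (M Y)(M X).
    MX≐MY : M ⊗ X ≐ M ⊗ Y
    MX≐MY = begin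
      M ⊗ X                  ≈⟨ ⊗-cong (≐-sym MYM≐M) (≐-refl {x = X}) ⟩
      ((M ⊗ Y) ⊗ M) ⊗ X      ≈⟨ ⊗-assoc (M ⊗ Y) M X ⟩
      (M ⊗ Y) ⊗ (M ⊗ X)      ≈⟨ ⊗-cong MY≐YM MX≐XM ⟩
      (Y ⊗ M) ⊗ (X ⊗ M)      ≈⟨ ⊗-assoc Y M (X ⊗ M) ⟩
      Y ⊗ (M ⊗ (X ⊗ M))      ≈⟨ ⊗-cong (≐-refl {x = Y}) (⊗-assoc M X M) ⟨
      Y ⊗ ((M ⊗ X) ⊗ M)      ≈⟨ ⊗-cong (≐-refl {x = Y}) MXM≐M ⟩
      Y ⊗ M                  ≈⟨ MY≐YM ⟨
      M ⊗ Y                  ∎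

  isGroupInverse-fromProjection : ∀ {M X P : Matrix n} →
    M ⊗ X ≐ P → X ⊗ M ≐ P → P ⊗ M ≐ M → P ⊗ X ≐ X → IsGroupInverse M X
  isGroupInverse-fromProjection {M = M} {X} MX≐P XM≐P PM≐M PX≐X =
    ≐-trans (⊗-cong MX≐P (≐-refl {x = M})) PM≐M ,
    ≐-trans (⊗-cong XM≐P (≐-refl {x = X})) PX≐X ,
    ≐-trans MX≐P (≐-sym XM≐P)

open GroupInverses

module BlockMatrices {n : ℕ} (part : Fin n → Part) (size : Part → ℚ)
  (sum-by-part : ∀ g → sum (g ∘ part) ≡ BlockAlgebra.Σᵖ ℚ.+-*-rawRing size g) where
  open BlockAlgebra ℚ.+-*-rawRing size
  open import Data.Rational using (_+_; _*_; -_; _-_)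
  open ≡-Reasoning

  ⟪_⟫ : Blocks → Matrix n
  ⟪ M ⟫ i j = δ i j * diag M (part i) + off M (part i) (part j)

  infix 4 _≋_
  _≋_ : Blocks → Blocks → Set
  M ≋ N = (∀ x → diag M x ≡ diag N x) × (∀ x y → off M x y ≡ off N x y)

  ⟪⟫-cong : ∀ {M N} → M ≋ N → ⟪ M ⟫ ≐ ⟪ N ⟫
  ⟪⟫-cong (diag≡ , off≡) i j = cong₂ _+_ (cong (δ i j *_) (diag≡ (part i))) (off≡ (part i) (part j))

  ⟪⟫-⊗ : ∀ M N → ⟪ M ⟫ ⊗ ⟪ N ⟫ ≐ ⟪ M · N ⟫
  ⟪⟫-⊗ M N i j = begin
    (⟪ M ⟫ ⊗ ⟪ N ⟫) i j
      ≡⟨ ⊗≡sum ⟪ M ⟫ ⟪ N ⟫ i j ⟩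
    sum (λ l → ⟪ M ⟫ i l * ⟪ N ⟫ l j)
      ≡⟨ sum-cong-≗ (λ l → expand (δ i l) (diag M x) (off M x (part l))
                                  (δ l j) (diag N (part l)) (off N (part l) y)) ⟩
    sum (λ l → δ i l * u l + (δ l j * v l + w l))
      ≡⟨ ∑-distrib-+ (λ l → δ i l * u l) (λ l → δ l j * v l + w l) ⟩
    sum (λ l → δ i l * u l) + sum (λ l → δ l j * v l + w l)
      ≡⟨ cong (sum (λ l → δ i l * u l) +_) (∑-distrib-+ (λ l → δ l j * v l) w) ⟩
    sum (λ l → δ i l * u l) + (sum (λ l → δ l j * v l) + sum w)
      ≡⟨ cong₂ _+_ (sum-δˡ i u) (cong₂ _+_ (sum-δʳ j v) (sum-by-part (λ e → off M x e * off N e y))) ⟩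
    u i + (v j + Σᵖ (λ e → off M x e * off N e y))
      ≡⟨ collect (δ i j) (diag M x) (diag N x) (off N x y) (off M x y) (diag N y) _ ⟩
    ⟪ M · N ⟫ i j
      ∎
    where
    x y : Part
    x = part i
    y = part j
    u v w : Fin n → ℚ
    u l = diag M x * ⟪ N ⟫ l j
    v l = off M x (part l) * diag N (part l)
    w l = off M x (part l) * off N (part l) y
    expand : ∀ δ₁ a b δ₂ c e →
      (δ₁ * a + b) * (δ₂ * c + e) ≡ δ₁ * (a * (δ₂ * c + e)) + (δ₂ * (b * c) + b * e)
    expand = Poly.solve 6 (λ δ₁ a b δ₂ c e →
      (δ₁ ⊠ a ⊕ b) ⊠ (δ₂ ⊠ c ⊕ e) ⊜ (δ₁ ⊠ (a ⊠ (δ₂ ⊠ c ⊕ e)) ⊕ (δ₂ ⊠ (b ⊠ c) ⊕ b ⊠ e))) refl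
    collect : ∀ δ₀ a c e b c′ s →
      a * (δ₀ * c + e) + (b * c′ + s) ≡ δ₀ * (a * c) + (a * e + b * c′ + s)
    collect = Poly.solve 7 (λ δ₀ a c e b c′ s →
      (a ⊠ (δ₀ ⊠ c ⊕ e) ⊕ (b ⊠ c′ ⊕ s)) ⊜ (δ₀ ⊠ (a ⊠ c) ⊕ (a ⊠ e ⊕ b ⊠ c′ ⊕ s))) refl

  centering : ℚ → Blocks
  centering β = blocks (λ _ → 1ℚ) (λ _ _ → β)

  centering-absorbs : ∀ β M → (∀ y → columnSum M y ≡ 0ℚ) → ⟪ centering β ⟫ ⊗ ⟪ M ⟫ ≐ ⟪ M ⟫
  centering-absorbs β M columnSum≡0 =
    ≐-trans (⟪⟫-⊗ (centering β) M) (⟪⟫-cong ((λ x → ℚ.*-identityˡ (diag M x)) , off≡))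
    where
    factor : ∀ β b c s₀ s₁ s₂ b₀ b₁ b₂ →
      1ℚ * b + β * c + (s₀ * (β * b₀) + (s₁ * (β * b₁) + s₂ * (β * b₂)))
        ≡ b + β * (c + (s₀ * b₀ + (s₁ * b₁ + s₂ * b₂)))
    factor = Poly.solve 9 (λ β b c s₀ s₁ s₂ b₀ b₁ b₂ →
      (Κ 1ℚ ⊠ b ⊕ β ⊠ c ⊕ (s₀ ⊠ (β ⊠ b₀) ⊕ (s₁ ⊠ (β ⊠ b₁) ⊕ s₂ ⊠ (β ⊠ b₂))))
        ⊜ (b ⊕ β ⊠ (c ⊕ (s₀ ⊠ b₀ ⊕ (s₁ ⊠ b₁ ⊕ s₂ ⊠ b₂))))) refl
    off≡ : ∀ x y → off (centering β · M) x y ≡ off M x y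
    off≡ x y = begin
      off (centering β · M) x y
        ≡⟨ factor β (off M x y) (diag M y) (size common) (size only₁) (size only₂)
                  (off M common y) (off M only₁ y) (off M only₂ y) ⟩
      off M x y + β * columnSum M y
        ≡⟨ cong (λ s → off M x y + β * s) (columnSum≡0 y) ⟩
      off M x y + β * 0ℚ
        ≡⟨ cong (off M x y +_) (ℚ.*-zeroʳ β) ⟩
      off M x y + 0ℚ
        ≡⟨ ℚ.+-identityʳ (off M x y) ⟩
      off M x y
        ∎

  ⟪⟫-diagonal : ∀ M i → ⟪ M ⟫ i i ≡ diag M (part i) + off M (part i) (part i)
  ⟪⟫-diagonal M i =
    cong (_+ off M (part i) (part i)) (trans (cong (_* diag M (part i)) (δ-refl i)) (ℚ.*-identityˡ (diag M (part i))))

  ⟪⟫-offDiagonal : ∀ M {i j} → ¬ i ≡ j → ⟪ M ⟫ i j ≡ off M (part i) (part j)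
  ⟪⟫-offDiagonal M {i} {j} i≢j = begin
    δ i j * diag M (part i) + off M (part i) (part j) ≡⟨ cong (λ z → z * diag M (part i) + off M (part i) (part j)) (δ-≢ i≢j) ⟩
    0ℚ * diag M (part i) + off M (part i) (part j)    ≡⟨ cong (_+ off M (part i) (part j)) (ℚ.*-zeroˡ (diag M (part i))) ⟩
    0ℚ + off M (part i) (part j)                      ≡⟨ ℚ.+-identityˡ _ ⟩
    off M (part i) (part j)                           ∎

  resistance-⟪⟫ : ∀ M {i j} → ¬ i ≡ j → resistance ⟪ M ⟫ i j ≡ blockResistance M (part i) (part j)
  resistance-⟪⟫ M {i} {j} i≢j = cong₂ (λ a b → a - 2# * b)
    (cong₂ _+_ (⟪⟫-diagonal M i) (⟪⟫-diagonal M j)) (⟪⟫-offDiagonal M i≢j)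

open import Data.Nat using (_+_; _*_; _∸_)
open import Data.Integer using (+_)

ι : ℕ → ℚ
ι m = frac m 1

toℚᵘ-frac : ∀ a m → ℚ.toℚᵘ (frac a (suc m)) ℚᵘ.≃ mkℚᵘ (+ a) m
toℚᵘ-frac a m = ℚ.toℚᵘ-fromℚᵘ (mkℚᵘ (+ a) m)

ι-+ : ∀ m n → ι (m + n) ≡ ι m ℚ.+ ι n
ι-+ m n = ℚ.toℚᵘ-injective (begin
  ℚ.toℚᵘ (ι (m + n))                      ≈⟨ toℚᵘ-frac (m + n) 0 ⟩
  mkℚᵘ (+ (m + n)) 0                       ≈⟨ *≡* (sum-of-wholes (+ m) (+ n)) ⟩
  mkℚᵘ (+ m) 0 ℚᵘ.+ mkℚᵘ (+ n) 0           ≈⟨ ℚᵘ.+-cong (toℚᵘ-frac m 0) (toℚᵘ-frac n 0) ⟨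
  ℚ.toℚᵘ (ι m) ℚᵘ.+ ℚ.toℚᵘ (ι n)          ≈⟨ ℚ.toℚᵘ-homo-+ (ι m) (ι n) ⟨
  ℚ.toℚᵘ (ι m ℚ.+ ι n)                    ∎)
  where
  open ℚᵘ.≃-Reasoning
  sum-of-wholes : ∀ x y → (x ℤ.+ y) ℤ.* (+ 1 ℤ.* + 1) ≡ (x ℤ.* + 1 ℤ.+ y ℤ.* + 1) ℤ.* + 1
  sum-of-wholes = ℤ-Solver.solve-∀

ι-* : ∀ m n → ι (m * n) ≡ ι m ℚ.* ι n
ι-* m n = ℚ.toℚᵘ-injective (begin
  ℚ.toℚᵘ (ι (m * n))                      ≈⟨ toℚᵘ-frac (m * n) 0 ⟩
  mkℚᵘ (+ (m * n)) 0                       ≡⟨ cong (λ z → mkℚᵘ z 0) (ℤ.pos-* m n) ⟩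
  mkℚᵘ (+ m ℤ.* + n) 0                     ≈⟨ *≡* (product-of-wholes (+ m) (+ n)) ⟩
  mkℚᵘ (+ m) 0 ℚᵘ.* mkℚᵘ (+ n) 0           ≈⟨ ℚᵘ.*-cong (toℚᵘ-frac m 0) (toℚᵘ-frac n 0) ⟨
  ℚ.toℚᵘ (ι m) ℚᵘ.* ℚ.toℚᵘ (ι n)          ≈⟨ ℚ.toℚᵘ-homo-* (ι m) (ι n) ⟨
  ℚ.toℚᵘ (ι m ℚ.* ι n)                    ∎)
  where
  open ℚᵘ.≃-Reasoning
  product-of-wholes : ∀ x y → (x ℤ.* y) ℤ.* (+ 1 ℤ.* + 1) ≡ (x ℤ.* y) ℤ.* + 1
  product-of-wholes = ℤ-Solver.solve-∀

ι-*-frac : ∀ a {D} → 1 ≤ D → ι D ℚ.* frac a D ≡ ι a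
ι-*-frac a {suc m} _ = ℚ.toℚᵘ-injective (begin
  ℚ.toℚᵘ (ι (suc m) ℚ.* frac a (suc m))            ≈⟨ ℚ.toℚᵘ-homo-* (ι (suc m)) (frac a (suc m)) ⟩
  ℚ.toℚᵘ (ι (suc m)) ℚᵘ.* ℚ.toℚᵘ (frac a (suc m))  ≈⟨ ℚᵘ.*-cong (toℚᵘ-frac (suc m) 0) (toℚᵘ-frac a m) ⟩
  mkℚᵘ (+ suc m) 0 ℚᵘ.* mkℚᵘ (+ a) m               ≈⟨ *≡* (cancel (+ a) (+ suc m)) ⟩
  mkℚᵘ (+ a) 0                                      ≈⟨ toℚᵘ-frac a 0 ⟨
  ℚ.toℚᵘ (ι a)                                     ∎)
  where
  open ℚᵘ.≃-Reasoning
  cancel : ∀ x y → (y ℤ.* x) ℤ.* + 1 ≡ x ℤ.* (+ 1 ℤ.* y)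
  cancel = ℤ-Solver.solve-∀

ι-∸ : ∀ {m n} → n ≤ m → ι (m ∸ n) ≡ ι m ℚ.- ι n
ι-∸ {m} {n} n≤m = begin
  ι (m ∸ n)                            ≡⟨ ℚ.+-identityʳ (ι (m ∸ n)) ⟨
  ι (m ∸ n) ℚ.+ 0ℚ                     ≡⟨ cong (ι (m ∸ n) ℚ.+_) (ℚ.+-inverseʳ (ι n)) ⟨
  ι (m ∸ n) ℚ.+ (ι n ℚ.- ι n)          ≡⟨ ℚ.+-assoc (ι (m ∸ n)) (ι n) (ℚ.- ι n) ⟨
  (ι (m ∸ n) ℚ.+ ι n) ℚ.- ι n          ≡⟨ cong (ℚ._- ι n) (ι-+ (m ∸ n) n) ⟨
  ι (m ∸ n + n) ℚ.- ι n                ≡⟨ cong (λ z → ι z ℚ.- ι n) (ℕ.m∸n+n≡m n≤m) ⟩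
  ι m ℚ.- ι n                          ∎
  where open ≡-Reasoning

frac-unique : ∀ {r a D} → 1 ≤ D → ι D ℚ.* r ≡ ι a → r ≡ frac a D
frac-unique {r} {a} {D} 1≤D Dr≡a = begin
  r                           ≡⟨ ℚ.*-identityˡ r ⟨
  1ℚ ℚ.* r                    ≡⟨ cong (ℚ._* r) D⁻¹D≡1 ⟨
  D⁻¹ ℚ.* ι D ℚ.* r           ≡⟨ ℚ.*-assoc D⁻¹ (ι D) r ⟩
  D⁻¹ ℚ.* (ι D ℚ.* r)         ≡⟨ cong (D⁻¹ ℚ.*_) (trans Dr≡a (sym (ι-*-frac a 1≤D))) ⟩
  D⁻¹ ℚ.* (ι D ℚ.* frac a D)  ≡⟨ ℚ.*-assoc D⁻¹ (ι D) (frac a D) ⟨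
  D⁻¹ ℚ.* ι D ℚ.* frac a D    ≡⟨ cong (ℚ._* frac a D) D⁻¹D≡1 ⟩
  1ℚ ℚ.* frac a D             ≡⟨ ℚ.*-identityˡ (frac a D) ⟩
  frac a D                    ∎
  where
  open ≡-Reasoning
  D⁻¹ : ℚ
  D⁻¹ = frac 1 D
  D⁻¹D≡1 : D⁻¹ ℚ.* ι D ≡ 1ℚ
  D⁻¹D≡1 = trans (ℚ.*-comm D⁻¹ (ι D)) (ι-*-frac 1 1≤D)

part : ℕ → ℕ → ℕ → Part
part k p₁ v = if does (v <? k) then common else if does (v <? p₁) then only₁ else only₂

part-common : ∀ {k p₁ v} → v < k → part k p₁ v ≡ common
part-common {k} {p₁} {v} v<k =
  cong (λ b → if b then common else if does (v <? p₁) then only₁ else only₂) (dec-true (v <? k) v<k)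

part-only₁ : ∀ {k p₁ v} → k ≤ v → v < p₁ → part k p₁ v ≡ only₁
part-only₁ {k} {p₁} {v} k≤v v<p₁ = cong₂ (λ b c → if b then common else if c then only₁ else only₂)
  (dec-false (v <? k) (ℕ.≤⇒≯ k≤v)) (dec-true (v <? p₁) v<p₁)

part-only₂ : ∀ {k p₁ v} → k ≤ p₁ → p₁ ≤ v → part k p₁ v ≡ only₂
part-only₂ {k} {p₁} {v} k≤p₁ p₁≤v = cong₂ (λ b c → if b then common else if c then only₁ else only₂)
  (dec-false (v <? k) (ℕ.≤⇒≯ (ℕ.≤-trans k≤p₁ p₁≤v))) (dec-false (v <? p₁) (ℕ.≤⇒≯ p₁≤v))

inK1≡member₁ : ∀ {k p₁} → k ≤ p₁ → ∀ v → inK1 k p₁ v ≡ member₁ (part k p₁ v)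
inK1≡member₁ {k} {p₁} k≤p₁ v with v <? k | v <? p₁
... | yes v<k | _        = trans (dec-true (v <? p₁) (ℕ.<-≤-trans v<k k≤p₁))
                                 (cong member₁ (sym (part-common {p₁ = p₁} v<k)))
... | no v≮k  | yes v<p₁ = trans (dec-true (v <? p₁) v<p₁)
                                 (cong member₁ (sym (part-only₁ (ℕ.≮⇒≥ v≮k) v<p₁)))
... | no _    | no v≮p₁  = trans (dec-false (v <? p₁) v≮p₁)
                                 (cong member₁ (sym (part-only₂ k≤p₁ (ℕ.≮⇒≥ v≮p₁))))

inK2≡member₂ : ∀ {k p₁} → k ≤ p₁ → ∀ v → inK2 k p₁ v ≡ member₂ (part k p₁ v)
inK2≡member₂ {k} {p₁} k≤p₁ v with v <? k | v <? p₁
... | yes v<k | _        = trans (cong (_∨ does (p₁ ≤? v)) (dec-true (v <? k) v<k))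
                                 (cong member₂ (sym (part-common {p₁ = p₁} v<k)))
... | no v≮k  | yes v<p₁ = trans (cong₂ _∨_ (dec-false (v <? k) v≮k) (dec-false (p₁ ≤? v) (ℕ.<⇒≱ v<p₁)))
                                 (cong member₂ (sym (part-only₁ (ℕ.≮⇒≥ v≮k) v<p₁)))
... | no v≮k  | no v≮p₁  = trans (cong₂ _∨_ (dec-false (v <? k) v≮k) (dec-true (p₁ ≤? v) (ℕ.≮⇒≥ v≮p₁)))
                                 (cong member₂ (sym (part-only₂ k≤p₁ (ℕ.≮⇒≥ v≮p₁))))

sum-toℕ-+ : ∀ m n (f : ℕ → ℚ) →
  sum {m + n} (f ∘ toℕ) ≡ sum {m} (f ∘ toℕ) ℚ.+ sum {n} (f ∘ (_+_ m) ∘ toℕ)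
sum-toℕ-+ zero    n f = sym (ℚ.+-identityˡ _)
sum-toℕ-+ (suc m) n f =
  trans (cong (f 0 ℚ.+_) (sum-toℕ-+ m n (f ∘ suc))) (sym (ℚ.+-assoc (f 0) _ _))

sum-toℕ-constant : ∀ n {f : ℕ → ℚ} {x} → (∀ {v} → v < n → f v ≡ x) → sum {n} (f ∘ toℕ) ≡ ι n ℚ.* x
sum-toℕ-constant zero    {x = x} _   = sym (ℚ.*-zeroˡ x)
sum-toℕ-constant (suc n) {f} {x} f≡x = begin
  f 0 ℚ.+ sum {n} (f ∘ suc ∘ toℕ)   ≡⟨ cong₂ ℚ._+_ (f≡x (s≤s z≤n)) (sum-toℕ-constant n (λ v<n → f≡x (s≤s v<n))) ⟩
  x ℚ.+ ι n ℚ.* x                  ≡⟨ cong (ℚ._+ ι n ℚ.* x) (ℚ.*-identityˡ x) ⟨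
  1ℚ ℚ.* x ℚ.+ ι n ℚ.* x           ≡⟨ ℚ.*-distribʳ-+ x 1ℚ (ι n) ⟨
  (1ℚ ℚ.+ ι n) ℚ.* x               ≡⟨ cong (ℚ._* x) (ι-+ 1 n) ⟨
  ι (suc n) ℚ.* x                  ∎
  where open ≡-Reasoning

module Coalescence (k p₁ p₂ : ℕ) (1≤k : 1 ≤ k) (k≤p₁ : k ≤ p₁) (k≤p₂ : k ≤ p₂) where
  open ≡-Reasoning

  t : ℕ
  t = p₁ + p₂ ∸ k

  vertexPart : Fin t → Part
  vertexPart i = part k p₁ (toℕ i)

  d : ℚ
  d = frac 1 (k * p₁ * p₂ * t * t)

  module Q = CoalescenceBlocks ℚ.+-*-rawRing (ι k) (ι p₁) (ι p₂) d

  sum-by-part : ∀ g → sum (g ∘ vertexPart) ≡ Q.Σᵖ g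
  sum-by-part g = begin
    sum {t} (f ∘ toℕ)
      ≡⟨ cong (λ n → sum {n} (f ∘ toℕ)) t≡k+m₁+m₂ ⟩
    sum {k + (m₁ + m₂)} (f ∘ toℕ)
      ≡⟨ sum-toℕ-+ k (m₁ + m₂) f ⟩
    sum {k} (f ∘ toℕ) ℚ.+ sum {m₁ + m₂} (f ∘ _+_ k ∘ toℕ)
      ≡⟨ cong (sum {k} (f ∘ toℕ) ℚ.+_) (sum-toℕ-+ m₁ m₂ (f ∘ _+_ k)) ⟩
    sum {k} (f ∘ toℕ) ℚ.+ (sum {m₁} (f ∘ _+_ k ∘ toℕ) ℚ.+ sum {m₂} (f ∘ _+_ k ∘ _+_ m₁ ∘ toℕ))
      ≡⟨ cong₂ ℚ._+_ (sum-toℕ-constant k {f} on-T)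
                      (cong₂ ℚ._+_ (sum-toℕ-constant m₁ {f ∘ _+_ k} on-K₁)
                                   (sum-toℕ-constant m₂ {f ∘ _+_ k ∘ _+_ m₁} on-K₂)) ⟩
    ι k ℚ.* g common ℚ.+ (ι m₁ ℚ.* g only₁ ℚ.+ ι m₂ ℚ.* g only₂)
      ≡⟨ cong₂ (λ a b → ι k ℚ.* g common ℚ.+ (a ℚ.* g only₁ ℚ.+ b ℚ.* g only₂)) (ι-∸ k≤p₁) (ι-∸ k≤p₂) ⟩
    Q.Σᵖ g
      ∎
    where
    f : ℕ → ℚ
    f = g ∘ part k p₁
    m₁ m₂ : ℕ
    m₁ = p₁ ∸ k
    m₂ = p₂ ∸ k
    t≡k+m₁+m₂ : t ≡ k + (m₁ + m₂)
    t≡k+m₁+m₂ = trans (ℕ.+-∸-assoc p₁ k≤p₂) (trans (cong (_+ m₂) (sym (ℕ.m+[n∸m]≡n k≤p₁))) (ℕ.+-assoc k m₁ m₂))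
    on-T : ∀ {v} → v < k → f v ≡ g common
    on-T v<k = cong g (part-common {p₁ = p₁} v<k)
    on-K₁ : ∀ {v} → v < m₁ → f (k + v) ≡ g only₁
    on-K₁ {v} v<m₁ = cong g (part-only₁ (ℕ.m≤m+n k v)
      (ℕ.<-≤-trans (ℕ.+-monoʳ-< k v<m₁) (ℕ.≤-reflexive (ℕ.m+[n∸m]≡n k≤p₁))))
    on-K₂ : ∀ {v} → v < m₂ → f (k + (m₁ + v)) ≡ g only₂
    on-K₂ {v} _ = cong g (part-only₂ k≤p₁
      (subst (_≤ k + (m₁ + v)) (ℕ.m+[n∸m]≡n k≤p₁) (ℕ.+-monoʳ-≤ k (ℕ.m≤m+n m₁ v))))

  open BlockMatrices vertexPart Q.size sum-by-part
  open BlockIdentities (ι k) (ι p₁) (ι p₂) d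

  coalAdj≡ : ∀ i j → coalAdj k p₁ p₂ i j ≡ not (does (i ≟ j)) ∧ adjacent (vertexPart i) (vertexPart j)
  coalAdj≡ i j = cong (not (does (i ≟ j)) ∧_)
    (cong₂ _∨_ (cong₂ _∧_ (inK1≡member₁ k≤p₁ (toℕ i)) (inK1≡member₁ k≤p₁ (toℕ j)))
               (cong₂ _∧_ (inK2≡member₂ k≤p₁ (toℕ i)) (inK2≡member₂ k≤p₁ (toℕ j))))

  without-loops : ∀ i j (i≟j : Dec (i ≡ j)) →
    Q.𝟙 (not (does i≟j) ∧ adjacent (vertexPart i) (vertexPart j))
      ≡ Q.𝟙 (adjacent (vertexPart i) (vertexPart j)) ℚ.- (if does i≟j then 1ℚ else 0ℚ)
  without-loops i .i (yes refl) = sym (cong (λ b → Q.𝟙 b ℚ.- 1ℚ) (adjacent-refl (vertexPart i)))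
  without-loops i j  (no _)     = sym (ℚ.+-identityʳ _)

  adjacency≡ : ∀ i j →
    adjacencyMatrix (coalAdj k p₁ p₂) i j ≡ Q.𝟙 (adjacent (vertexPart i) (vertexPart j)) ℚ.- δ i j
  adjacency≡ i j = trans (cong Q.𝟙 (coalAdj≡ i j)) (without-loops i j (i ≟ j))

  degree≡ : ∀ i → degree (coalAdj k p₁ p₂) i ≡ Q.diag Q.L (vertexPart i) ℚ.- 1ℚ
  degree≡ i = begin
    sumFin t (adjacencyMatrix (coalAdj k p₁ p₂) i)
      ≡⟨ sumFin≡sum t (adjacencyMatrix (coalAdj k p₁ p₂) i) ⟩
    sum (adjacencyMatrix (coalAdj k p₁ p₂) i)
      ≡⟨ sum-cong-≗ (adjacency≡ i) ⟩
    sum (λ l → a l ℚ.+ ℚ.- δ i l)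
      ≡⟨ ∑-distrib-+ a (λ l → ℚ.- δ i l) ⟩
    sum a ℚ.+ sum (λ l → ℚ.- δ i l)
      ≡⟨ cong₂ ℚ._+_ (sum-by-part (Q.𝟙 ∘ adjacent (vertexPart i))) minus-one ⟩
    Q.diag Q.L (vertexPart i) ℚ.- 1ℚ
      ∎
    where
    a : Fin t → ℚ
    a l = Q.𝟙 (adjacent (vertexPart i) (vertexPart l))
    minus-one : sum (λ l → ℚ.- δ i l) ≡ ℚ.- 1ℚ
    minus-one = trans
      (sum-cong-≗ (λ l → trans (cong ℚ.-_ (sym (ℚ.*-identityʳ (δ i l)))) (ℚ.neg-distribʳ-* (δ i l) 1ℚ)))
      (sum-δˡ i (λ _ → ℚ.- 1ℚ))

  L₀ : Matrix t
  L₀ = laplacian (coalAdj k p₁ p₂)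

  laplacian≐ : L₀ ≐ ⟪ Q.L ⟫
  laplacian≐ i j = begin
    L₀ i j
      ≡⟨ cong₂ ℚ._-_ (trans (if≡δ* i j _) (cong (δ i j ℚ.*_) (degree≡ i))) (adjacency≡ i j) ⟩
    δ i j ℚ.* (D ℚ.- 1ℚ) ℚ.- (A ℚ.- δ i j)
      ≡⟨ regroup (δ i j) D A ⟩
    ⟪ Q.L ⟫ i j
      ∎
    where
    D A : ℚ
    D = Q.diag Q.L (vertexPart i)
    A = Q.𝟙 (adjacent (vertexPart i) (vertexPart j))
    regroup : ∀ δ₀ D A → δ₀ ℚ.* (D ℚ.- 1ℚ) ℚ.- (A ℚ.- δ₀) ≡ δ₀ ℚ.* D ℚ.+ ℚ.- A
    regroup = Poly.solve 3 (λ δ₀ D A →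
      (δ₀ ⊠ (D ⊕ Poly.⊝ Κ 1ℚ) ⊕ Poly.⊝ (A ⊕ Poly.⊝ δ₀)) ⊜ (δ₀ ⊠ D ⊕ Poly.⊝ A)) refl

  X₀ : Matrix t
  X₀ = ⟪ Q.X ⟫

  1≤p₁ : 1 ≤ p₁
  1≤p₁ = ℕ.≤-trans 1≤k k≤p₁

  1≤p₂ : 1 ≤ p₂
  1≤p₂ = ℕ.≤-trans 1≤k k≤p₂

  1≤t : 1 ≤ t
  1≤t = ℕ.≤-trans 1≤p₁ (subst (p₁ ≤_) (sym (ℕ.+-∸-assoc p₁ k≤p₂)) (ℕ.m≤m+n p₁ (p₂ ∸ k)))

  ι-t : ι t ≡ Q.t
  ι-t = trans (ι-∸ (ℕ.≤-trans k≤p₁ (ℕ.m≤m+n p₁ p₂))) (cong (ℚ._- ι k) (ι-+ p₁ p₂))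

  Δd≡1 : Q.Δ ℚ.* d ≡ 1ℚ
  Δd≡1 = trans (cong (ℚ._* d) (sym ι-Δ)) (ι-*-frac 1 1≤Δ)
    where
    ι-Δ : ι (k * p₁ * p₂ * t * t) ≡ Q.Δ
    ι-Δ = trans (ι-* (k * p₁ * p₂ * t) t) (cong₂ ℚ._*_
            (trans (ι-* (k * p₁ * p₂) t) (cong₂ ℚ._*_
              (trans (ι-* (k * p₁) p₂) (cong (ℚ._* ι p₂) (ι-* k p₁))) ι-t)) ι-t)
    1≤Δ : 1 ≤ k * p₁ * p₂ * t * t
    1≤Δ = ℕ.*-mono-≤ (ℕ.*-mono-≤ (ℕ.*-mono-≤ (ℕ.*-mono-≤ 1≤k 1≤p₁) 1≤p₂) 1≤t) 1≤t

  β : ℚ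
  β = Q.off Q.P common common

  P≋centering : Q.P ≋ centering β
  P≋centering = (λ _ → Δd≡1) , (λ _ _ → refl)

  L₀X₀≐P : L₀ ⊗ X₀ ≐ ⟪ Q.P ⟫
  L₀X₀≐P = ≐-trans (⊗-cong laplacian≐ (≐-refl {x = X₀}))
             (≐-trans (⟪⟫-⊗ Q.L Q.X) (⟪⟫-cong (L·X-diag , L·X-off)))

  X₀L₀≐P : X₀ ⊗ L₀ ≐ ⟪ Q.P ⟫
  X₀L₀≐P = ≐-trans (⊗-cong (≐-refl {x = X₀}) laplacian≐)
             (≐-trans (⟪⟫-⊗ Q.X Q.L) (⟪⟫-cong (X·L-diag , X·L-off)))

  PL₀≐L₀ : ⟪ Q.P ⟫ ⊗ L₀ ≐ L₀
  PL₀≐L₀ = ≐-trans (⊗-cong (⟪⟫-cong P≋centering) laplacian≐)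
             (≐-trans (centering-absorbs β Q.L L-columnSum) (≐-sym laplacian≐))

  PX₀≐X₀ : ⟪ Q.P ⟫ ⊗ X₀ ≐ X₀
  PX₀≐X₀ = ≐-trans (⊗-cong (⟪⟫-cong P≋centering) (≐-refl {x = X₀})) (centering-absorbs β Q.X X-columnSum)

  X₀-isGroupInverse : IsGroupInverse L₀ X₀
  X₀-isGroupInverse = isGroupInverse-fromProjection L₀X₀≐P X₀L₀≐P PL₀≐L₀ PX₀≐X₀

  blockResistance≡frac : ∀ x y {a D a′ D′} → 1 ≤ D → ι D ≡ D′ → ι a ≡ a′ →
    D′ ℚ.* Q.blockResistance Q.X x y ≡ a′ ℚ.* (Q.Δ ℚ.* d) → Q.blockResistance Q.X x y ≡ frac a D
  blockResistance≡frac x y {a} {D} {a′} {D′} 1≤D ιD≡D′ ιa≡a′ scaled = frac-unique 1≤D (begin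
    ι D ℚ.* r           ≡⟨ cong (ℚ._* r) ιD≡D′ ⟩
    D′ ℚ.* r            ≡⟨ scaled ⟩
    a′ ℚ.* (Q.Δ ℚ.* d)  ≡⟨ cong (a′ ℚ.*_) Δd≡1 ⟩
    a′ ℚ.* 1ℚ           ≡⟨ ℚ.*-identityʳ a′ ⟩
    a′                  ≡⟨ ιa≡a′ ⟨
    ι a                 ∎)
    where
    r : ℚ
    r = Q.blockResistance Q.X x y

  vertexPart-T : ∀ {i} → InT k p₁ i → vertexPart i ≡ common
  vertexPart-T = part-common {p₁ = p₁}

  vertexPart-K₁ : ∀ {i} → InK1∖T k p₁ i → vertexPart i ≡ only₁
  vertexPart-K₁ (k≤i , i<p₁) = part-only₁ k≤i i<p₁

  vertexPart-K₂ : ∀ {i} → InK2∖T k p₁ i → vertexPart i ≡ only₂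
  vertexPart-K₂ = part-only₂ k≤p₁

  module _ {X : Matrix t} (X-inverse : IsGroupInverse L₀ X) where
    resistance-at : ∀ {i j x y} → ¬ i ≡ j → vertexPart i ≡ x → vertexPart j ≡ y →
      resistance X i j ≡ Q.blockResistance Q.X x y
    resistance-at {i} {j} i≢j refl refl =
      trans (resistance-cong (isGroupInverse-unique X-inverse X₀-isGroupInverse) i j) (resistance-⟪⟫ Q.X i≢j)

    resistance-T-T : ∀ i j → ¬ i ≡ j → InT k p₁ i → InT k p₁ j → resistance X i j ≡ frac 2 t
    resistance-T-T i j i≢j i∈T j∈T =
      trans (resistance-at i≢j (vertexPart-T i∈T) (vertexPart-T j∈T))
            (blockResistance≡frac common common 1≤t ι-t refl blockResistance-T-T)

    resistance-T-K₁ : ∀ i j → InT k p₁ i → InK1∖T k p₁ j →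
      resistance X i j ≡ frac ((k + 1) * (p₂ ∸ k) + 2 * p₁ * k) (k * p₁ * t)
    resistance-T-K₁ i j i∈T (k≤j , j<p₁) =
      trans (resistance-at i≢j (vertexPart-T i∈T) (vertexPart-K₁ (k≤j , j<p₁)))
            (blockResistance≡frac common only₁ (ℕ.*-mono-≤ (ℕ.*-mono-≤ 1≤k 1≤p₁) 1≤t)
              (trans (ι-* (k * p₁) t) (cong₂ ℚ._*_ (ι-* k p₁) ι-t))
              (trans (ι-+ ((k + 1) * (p₂ ∸ k)) (2 * p₁ * k)) (cong₂ ℚ._+_
                (trans (ι-* (k + 1) (p₂ ∸ k)) (cong₂ ℚ._*_ (ι-+ k 1) (ι-∸ k≤p₂)))
                (trans (ι-* (2 * p₁) k) (cong (ℚ._* ι k) (ι-* 2 p₁)))))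
              blockResistance-T-K₁)
      where
      i≢j : ¬ i ≡ j
      i≢j refl = ℕ.<⇒≱ i∈T k≤j

    resistance-T-K₂ : ∀ i j → InT k p₁ i → InK2∖T k p₁ j →
      resistance X i j ≡ frac ((k + 1) * (p₁ ∸ k) + 2 * p₂ * k) (k * p₂ * t)
    resistance-T-K₂ i j i∈T p₁≤j =
      trans (resistance-at i≢j (vertexPart-T i∈T) (vertexPart-K₂ p₁≤j))
            (blockResistance≡frac common only₂ (ℕ.*-mono-≤ (ℕ.*-mono-≤ 1≤k 1≤p₂) 1≤t)
              (trans (ι-* (k * p₂) t) (cong₂ ℚ._*_ (ι-* k p₂) ι-t))
              (trans (ι-+ ((k + 1) * (p₁ ∸ k)) (2 * p₂ * k)) (cong₂ ℚ._+_
                (trans (ι-* (k + 1) (p₁ ∸ k)) (cong₂ ℚ._*_ (ι-+ k 1) (ι-∸ k≤p₁)))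
                (trans (ι-* (2 * p₂) k) (cong (ℚ._* ι k) (ι-* 2 p₂)))))
              blockResistance-T-K₂)
      where
      i≢j : ¬ i ≡ j
      i≢j refl = ℕ.<⇒≱ i∈T (ℕ.≤-trans k≤p₁ p₁≤j)

    resistance-K₁-K₁ : ∀ i j → ¬ i ≡ j → InK1∖T k p₁ i → InK1∖T k p₁ j → resistance X i j ≡ frac 2 p₁
    resistance-K₁-K₁ i j i≢j (k≤i , i<p₁) (k≤j , j<p₁) =
      trans (resistance-at i≢j (vertexPart-K₁ (k≤i , i<p₁)) (vertexPart-K₁ (k≤j , j<p₁)))
            (blockResistance≡frac only₁ only₁ 1≤p₁ refl refl blockResistance-K₁-K₁)

    resistance-K₁-K₂ : ∀ i j → InK1∖T k p₁ i → InK2∖T k p₁ j →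
      resistance X i j ≡ frac ((p₁ + p₂) * (k + 1)) (k * p₁ * p₂)
    resistance-K₁-K₂ i j (k≤i , i<p₁) p₁≤j =
      trans (resistance-at i≢j (vertexPart-K₁ (k≤i , i<p₁)) (vertexPart-K₂ p₁≤j))
            (blockResistance≡frac only₁ only₂ (ℕ.*-mono-≤ (ℕ.*-mono-≤ 1≤k 1≤p₁) 1≤p₂)
              (trans (ι-* (k * p₁) p₂) (cong (ℚ._* ι p₂) (ι-* k p₁)))
              (trans (ι-* (p₁ + p₂) (k + 1)) (cong₂ ℚ._*_ (ι-+ p₁ p₂) (ι-+ k 1)))
              blockResistance-K₁-K₂)
      where
      i≢j : ¬ i ≡ j
      i≢j refl = ℕ.<⇒≱ i<p₁ p₁≤j

    resistance-K₂-K₂ : ∀ i j → ¬ i ≡ j → InK2∖T k p₁ i → InK2∖T k p₁ j → resistance X i j ≡ frac 2 p₂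
    resistance-K₂-K₂ i j i≢j p₁≤i p₁≤j =
      trans (resistance-at i≢j (vertexPart-K₂ p₁≤i) (vertexPart-K₂ p₁≤j))
            (blockResistance≡frac only₂ only₂ 1≤p₂ refl refl blockResistance-K₂-K₂)

theorem3p1 : (k p1 p2 : ℕ) → 1 ≤ k → k ≤ p1 → k ≤ p2 →
    let t = p1 + p2 ∸ k
        L = laplacian (coalAdj k p1 p2)
    in Σ (Matrix t) (λ X → IsGroupInverse L X) ×
       ((X : Matrix t) → IsGroupInverse L X →
         let r = resistance X in
         ((i j : Fin t) → ¬ i ≡ j → InT k p1 i → InT k p1 j →
            r i j ≡ frac 2 t) ×
         ((i j : Fin t) → InT k p1 i → InK1∖T k p1 j →
            r i j ≡ frac ((k + 1) * (p2 ∸ k) + 2 * p1 * k) (k * p1 * t)) ×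
         ((i j : Fin t) → InT k p1 i → InK2∖T k p1 j →
            r i j ≡ frac ((k + 1) * (p1 ∸ k) + 2 * p2 * k) (k * p2 * t)) ×
         ((i j : Fin t) → ¬ i ≡ j → InK1∖T k p1 i → InK1∖T k p1 j →
            r i j ≡ frac 2 p1) ×
         ((i j : Fin t) → InK1∖T k p1 i → InK2∖T k p1 j →
            r i j ≡ frac ((p1 + p2) * (k + 1)) (k * p1 * p2)) ×
         ((i j : Fin t) → ¬ i ≡ j → InK2∖T k p1 i → InK2∖T k p1 j →
            r i j ≡ frac 2 p2))
theorem3p1 k p1 p2 1≤k k≤p1 k≤p2 =
  (X₀ , X₀-isGroupInverse) , λ X X-inverse →
    resistance-T-T X-inverse , resistance-T-K₁ X-inverse , resistance-T-K₂ X-inverse ,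
    resistance-K₁-K₁ X-inverse , resistance-K₁-K₂ X-inverse , resistance-K₂-K₂ X-inverse
  where open Coalescence k p1 p2 1≤k k≤p1 k≤p2
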